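{- Let $\mathcal K$ be a GL model and let $t_{\mathcal K}\colon\mathcal L^{{\Diamond}^\ast}_{{\Diamond}\forall}\to\mathcal L_{{\Diamond}\forall}$ be the translation that commutes with $\top,\bot$, literals, $\wedge,\vee$ and ${\Diamond},{\Box},\forall,\exists$, and sets $t_{\mathcal K}({\Diamond}^\ast\Phi)=\top$ if $\bigwedge\Phi$ is true at $(\hat{\mathcal K},\infty)$ and $\bot$ otherwise, and $t_{\mathcal K}({\Box}^\ast\Phi)=\top$ if $\bigvee\Phi$ is true at $(\hat{\mathcal K},\infty)$ and $\bot$ otherwise. Then for every $\varphi\in\mathcal L^{{\Diamond}^\ast}_{{\Diamond}\forall}$, $t_{\mathcal K}(\varphi)$ and $\varphi$ have the same truth set in the model $\hat{\mathcal K}$.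
   Context: A GL model is a Kripke model $(W,R,V)$ with $R$ transitive and converse well-founded (no infinite chains $a_0Ra_1Ra_2R\cdots$). For a Kripke model $\mathcal K=(W,R,V)$, $\hat{\mathcal K}$ has domain $W\cup\{\infty\}$ ($\infty$ a new point), relation $R\cup((W\cup\{\infty\})\times\{\infty\})$, and valuation extending $V$ with no variable true at $\infty$. $\mathcal L_{{\Diamond}\forall}$: negation-normal-form formulas built from $\top,\bot$, literals $p,\overline p$, $\wedge,\vee,{\Diamond},{\Box},\forall,\exists$; $\mathcal L^{{\Diamond}^\ast}_{{\Diamond}\forall}$ additionally allows ${\Diamond}^\ast\Phi$, ${\Box}^\ast\Phi$ for finite sets $\Phi$ of formulas. In a Kripke model with transitive relation, ${\Diamond},{\Box}$ are relational; $\forall\varphi$ ($\exists\varphi$) holds everywhere if $\varphi$ holds at all (some) points and nowhere otherwise; ${\Diamond}^\ast\{\varphi_1,\dots,\varphi_k\}$ holds at $x$ iff there is a set $S$ of points with $x\in S$ such that every point of $S$ has, for each $i$, an $R$-successor in $S$ satisfying $\varphi_i$; ${\Box}^\ast\{\varphi_1,\dots,\varphi_k\}$ holds exactly where ${\Diamond}^\ast\{\neg\varphi_1,\dots,\neg\varphi_k\}$ fails ($\neg$ the De Morgan dual). -}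

module Defs where

open import Level using (Level; 0ℓ; Lift) renaming (suc to lsuc)
open import Data.Nat using (ℕ; suc)
open import Data.Fin using (Fin)
open import Data.Maybe using (Maybe; just; nothing)
open import Data.Product using (Σ; _×_)
open import Data.Sum using (_⊎_)
open import Data.Unit using (⊤; tt)
open import Data.Empty using (⊥)
open import Relation.Nullary using (¬_; yes; no)
open import Relation.Binary.Definitions using (Transitive)
open import Axiom.ExcludedMiddle using (ExcludedMiddle)

record KripkeModel : Set₁ where
  field
    W : Set
    R : W → W → Set
    V : ℕ → W → Set

open KripkeModel public

-- GL model: R transitive and converse well-founded
-- (no infinite chains a₀ R a₁ R a₂ R ⋯).
IsGL : KripkeModel → Set
IsGL K = Transitive (R K)
       × ¬ (Σ (ℕ → W K) λ f → ∀ n → R K (f n) (f (suc n)))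

-- The model K̂ : points are Maybe W, with nothing playing the role of ∞.
∞ : {A : Set} → Maybe A
∞ = nothing

hatR : (K : KripkeModel) → Maybe (W K) → Maybe (W K) → Set
hatR K (just a) (just b) = R K a b
hatR K nothing  (just b) = ⊥
hatR K _        nothing  = ⊤

hatV : (K : KripkeModel) → ℕ → Maybe (W K) → Set
hatV K p (just a) = V K p a
hatV K p nothing  = ⊥

hat : KripkeModel → KripkeModel
hat K = record { W = Maybe (W K) ; R = hatR K ; V = hatV K }

-- Formulas of L^{◇*}_{◇∀} in negation normal form.
-- A finite set Φ = {φ₁,…,φₖ} is given as a family Fin k → Form.
data Form : Set where
  ⊤' ⊥'       : Form
  var nvar    : ℕ → Form
  _∧'_ _∨'_   : Form → Form → Form
  ◇ □ ∀' ∃'   : Form → Form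
  ◇* □*       : (k : ℕ) → (Fin k → Form) → Form

neg : Form → Form
neg ⊤' = ⊥'
neg ⊥' = ⊤'
neg (var p) = nvar p
neg (nvar p) = var p
neg (φ ∧' ψ) = neg φ ∨' neg ψ
neg (φ ∨' ψ) = neg φ ∧' neg ψ
neg (◇ φ) = □ (neg φ)
neg (□ φ) = ◇ (neg φ)
neg (∀' φ) = ∃' (neg φ)
neg (∃' φ) = ∀' (neg φ)
neg (◇* k Φ) = □* k (λ i → neg (Φ i))
neg (□* k Φ) = ◇* k (λ i → neg (Φ i))

-- Semantics in a (transitive) Kripke model.
-- sat M φ x : φ holds at x;  satNeg M φ x : neg φ holds at x
-- (defined simultaneously, clause by clause as for sat (neg φ), so that
-- recursion is structural).
module Semantics (M : KripkeModel) where
  private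
    X = W M
    _≺_ = R M

  DiamondStar : (k : ℕ) → (Fin k → X → Set₁) → X → Set₁
  DiamondStar k P x =
    Σ (X → Set) λ S → S x ×
      (∀ y → S y → (i : Fin k) → Σ X λ z → (y ≺ z) × S z × P i z)

  sat satNeg : Form → X → Set₁
  sat ⊤' x = Lift _ ⊤
  sat ⊥' x = Lift _ ⊥
  sat (var p) x = Lift _ (V M p x)
  sat (nvar p) x = Lift _ (¬ V M p x)
  sat (φ ∧' ψ) x = sat φ x × sat ψ x
  sat (φ ∨' ψ) x = sat φ x ⊎ sat ψ x
  sat (◇ φ) x = Σ X λ y → (x ≺ y) × sat φ y
  sat (□ φ) x = ∀ y → x ≺ y → sat φ y
  sat (∀' φ) x = ∀ y → sat φ y
  sat (∃' φ) x = Σ X λ y → sat φ y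
  sat (◇* k Φ) x = DiamondStar k (λ i → sat (Φ i)) x
  sat (□* k Φ) x = ¬ DiamondStar k (λ i → satNeg (Φ i)) x

  satNeg ⊤' x = sat ⊥' x
  satNeg ⊥' x = sat ⊤' x
  satNeg (var p) x = sat (nvar p) x
  satNeg (nvar p) x = sat (var p) x
  satNeg (φ ∧' ψ) x = satNeg φ x ⊎ satNeg ψ x
  satNeg (φ ∨' ψ) x = satNeg φ x × satNeg ψ x
  satNeg (◇ φ) x = ∀ y → x ≺ y → satNeg φ y
  satNeg (□ φ) x = Σ X λ y → (x ≺ y) × satNeg φ y
  satNeg (∀' φ) x = Σ X λ y → satNeg φ y
  satNeg (∃' φ) x = ∀ y → satNeg φ y
  satNeg (◇* k Φ) x = ¬ DiamondStar k (λ i → sat (Φ i)) x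
  satNeg (□* k Φ) x = DiamondStar k (λ i → satNeg (Φ i)) x

open Semantics public

BigAnd BigOr : (M : KripkeModel) (k : ℕ) → (Fin k → Form) → W M → Set₁
BigAnd M k Φ x = (i : Fin k) → sat M (Φ i) x
BigOr  M k Φ x = Σ (Fin k) λ i → sat M (Φ i) x

-- The translation t_K.  Deciding whether ⋀Φ / ⋁Φ is true at (K̂,∞)
-- uses excluded middle (the paper's metatheory is classical).
module _ (lem : ExcludedMiddle (lsuc 0ℓ)) (K : KripkeModel) where
  t : Form → Form
  t ⊤' = ⊤'
  t ⊥' = ⊥'
  t (var p) = var p
  t (nvar p) = nvar p
  t (φ ∧' ψ) = t φ ∧' t ψ
  t (φ ∨' ψ) = t φ ∨' t ψ
  t (◇ φ) = ◇ (t φ)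
  t (□ φ) = □ (t φ)
  t (∀' φ) = ∀' (t φ)
  t (∃' φ) = ∃' (t φ)
  t (◇* k Φ) with lem {BigAnd (hat K) k Φ ∞}
  ... | yes _ = ⊤'
  ... | no  _ = ⊥'
  t (□* k Φ) with lem {BigOr (hat K) k Φ ∞}
  ... | yes _ = ⊤'
  ... | no  _ = ⊥'

-- The proof is an induction on φ in which all connectives except ◇*, □*
-- are congruences.  The content lies in one fact about K̂ for a GL model K:
--
--   (★) ◇*{P₁,…,Pₖ} holds at any point of K̂  iff  every Pᵢ holds at ∞.
--
-- "⇐": the whole model is a witness set, since every point sees ∞.
-- "⇒": take a witness set S.  If ∞ ∈ S, the successors demanded at ∞ can
-- only be ∞ itself, so every Pᵢ holds at ∞.  If ∞ ∉ S (and k > 0), then S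
-- is a nonempty set of points of K in which every point has a successor in
-- S; iterating this gives an infinite ascending chain, contradicting
-- converse well-foundedness.
-- For □* we additionally need, classically, that ¬⋀ᵢ(neg φᵢ) is ⋁ᵢ φᵢ,
-- which rests on sat/satNeg being complementary in every Kripke model.
module Submission where

open import Defs
open import Level using (0ℓ; Lift; lift) renaming (suc to lsuc)
open import Function.Bundles using (_⇔_; mk⇔; module Equivalence)
import Function.Properties.Equivalence as ⇔
open import Function.Related.TypeIsomorphisms using (¬-cong-⇔)
open import Data.Product.Function.NonDependent.Propositional using (_×-⇔_)
open import Data.Sum.Function.Propositional using (_⊎-⇔_)
open import Axiom.ExcludedMiddle using (ExcludedMiddle)
open import Data.Nat using (ℕ; zero; suc)
open import Data.Fin using (Fin; zero)
open import Data.Maybe using (Maybe; just; nothing)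
open import Data.Product using (Σ; _×_; _,_; proj₁; proj₂)
open import Data.Sum using (_⊎_; inj₁; inj₂; swap)
open import Data.Unit using (⊤; tt)
open import Data.Empty using (⊥-elim)
open import Relation.Nullary using (¬_; yes; no)

open Equivalence using (to; from)

⊤'⇔ : (M : KripkeModel) (x : W M) {C : Set₁} → C → sat M ⊤' x ⇔ C
⊤'⇔ M x c = mk⇔ (λ _ → c) (λ _ → lift tt)

⊥'⇔ : (M : KripkeModel) (x : W M) {C : Set₁} → ¬ C → sat M ⊥' x ⇔ C
⊥'⇔ M x ¬c = mk⇔ (λ { (lift ()) }) (λ c → ⊥-elim (¬c c))

-- A nonempty set of points in which every point has a successor in the set
-- yields an infinite ascending chain, so it cannot exist in a model whose
-- relation is converse well-founded.
noSerialSubset : (K : KripkeModel) → IsGL K →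
  (S : W K → Set) → (∀ a → S a → Σ (W K) λ b → R K a b × S b) →
  ∀ a → ¬ S a
noSerialSubset K (_ , converseWF) S serial a sa =
  converseWF ((λ n → proj₁ (chain n)) , step)
  where
  chain : ℕ → Σ (W K) S
  chain zero    = a , sa
  chain (suc n) = let (b , _ , sb) = serial _ (proj₂ (chain n)) in b , sb

  step : ∀ n → R K (proj₁ (chain n)) (proj₁ (chain (suc n)))
  step n = proj₁ (proj₂ (serial _ (proj₂ (chain n))))

satNeg-disjoint : (M : KripkeModel) (φ : Form) (x : W M) →
  satNeg M φ x → ¬ sat M φ x
satNeg-disjoint M ⊤' x (lift ()) _
satNeg-disjoint M ⊥' x _ (lift ())
satNeg-disjoint M (var p) x (lift ¬v) (lift v) = ¬v v
satNeg-disjoint M (nvar p) x (lift v) (lift ¬v) = ¬v v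
satNeg-disjoint M (φ ∧' ψ) x (inj₁ n) (s , _) = satNeg-disjoint M φ x n s
satNeg-disjoint M (φ ∧' ψ) x (inj₂ n) (_ , s) = satNeg-disjoint M ψ x n s
satNeg-disjoint M (φ ∨' ψ) x (n , _) (inj₁ s) = satNeg-disjoint M φ x n s
satNeg-disjoint M (φ ∨' ψ) x (_ , n) (inj₂ s) = satNeg-disjoint M ψ x n s
satNeg-disjoint M (◇ φ) x n (y , r , s) = satNeg-disjoint M φ y (n y r) s
satNeg-disjoint M (□ φ) x (y , r , n) s = satNeg-disjoint M φ y n (s y r)
satNeg-disjoint M (∀' φ) x (y , n) s = satNeg-disjoint M φ y n (s y)
satNeg-disjoint M (∃' φ) x n (y , s) = satNeg-disjoint M φ y (n y) s
satNeg-disjoint M (◇* k Φ) x n s = n s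
satNeg-disjoint M (□* k Φ) x n s = s n

module _ (lem : ExcludedMiddle (lsuc 0ℓ)) where

  decide : {P Q : Set₁} → (¬ P → Q) → P ⊎ Q
  decide {P} ¬P⇒Q with lem {P}
  ... | yes p = inj₁ p
  ... | no ¬p = inj₂ (¬P⇒Q ¬p)

  otherwise : {A B : Set₁} → A ⊎ B → ¬ A → B
  otherwise (inj₁ a) ¬a = ⊥-elim (¬a a)
  otherwise (inj₂ b) _  = b

  satNeg-exhaustive : (M : KripkeModel) (φ : Form) (x : W M) →
    sat M φ x ⊎ satNeg M φ x
  satNeg-exhaustive M ⊤' x = inj₁ (lift tt)
  satNeg-exhaustive M ⊥' x = inj₂ (lift tt)
  satNeg-exhaustive M (var p) x = decide λ ¬v → lift (λ v → ¬v (lift v))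
  satNeg-exhaustive M (nvar p) x =
    swap (decide λ ¬v → lift (λ v → ¬v (lift v)))
  satNeg-exhaustive M (φ ∧' ψ) x with satNeg-exhaustive M φ x | satNeg-exhaustive M ψ x
  ... | inj₁ a | inj₁ b = inj₁ (a , b)
  ... | inj₂ a | _      = inj₂ (inj₁ a)
  ... | _      | inj₂ b = inj₂ (inj₂ b)
  satNeg-exhaustive M (φ ∨' ψ) x with satNeg-exhaustive M φ x | satNeg-exhaustive M ψ x
  ... | inj₁ a | _      = inj₁ (inj₁ a)
  ... | _      | inj₁ b = inj₁ (inj₂ b)
  ... | inj₂ a | inj₂ b = inj₂ (a , b)
  satNeg-exhaustive M (◇ φ) x = decide λ ¬s y r →
    otherwise (satNeg-exhaustive M φ y) (λ s → ¬s (y , r , s))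
  satNeg-exhaustive M (□ φ) x = swap (decide λ ¬n y r →
    otherwise (swap (satNeg-exhaustive M φ y)) (λ n → ¬n (y , r , n)))
  satNeg-exhaustive M (∀' φ) x = swap (decide λ ¬n y →
    otherwise (swap (satNeg-exhaustive M φ y)) (λ n → ¬n (y , n)))
  satNeg-exhaustive M (∃' φ) x = decide λ ¬s y →
    otherwise (satNeg-exhaustive M φ y) (λ s → ¬s (y , s))
  satNeg-exhaustive M (◇* k Φ) x = decide λ ¬s → ¬s
  satNeg-exhaustive M (□* k Φ) x = swap (decide λ ¬n → ¬n)

  notAllNeg⇔BigOr : (M : KripkeModel) (k : ℕ) (Φ : Fin k → Form) (x : W M) →
    (¬ (∀ i → satNeg M (Φ i) x)) ⇔ BigOr M k Φ x
  notAllNeg⇔BigOr M k Φ x = mk⇔ someSat noneNeg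
    where
    noneNeg : BigOr M k Φ x → ¬ (∀ i → satNeg M (Φ i) x)
    noneNeg (i , s) allNeg = satNeg-disjoint M (Φ i) x (allNeg i) s

    someSat : ¬ (∀ i → satNeg M (Φ i) x) → BigOr M k Φ x
    someSat ¬allNeg with lem {BigOr M k Φ x}
    ... | yes some = some
    ... | no ¬some = ⊥-elim (¬allNeg λ i →
      otherwise (satNeg-exhaustive M (Φ i) x) (λ s → ¬some (i , s)))

  module _ (K : KripkeModel) where
    private
      X = Maybe (W K)

    -- A witness set for ◇* that contains ∞ shows every Pᵢ at ∞, because the
    -- only successor of ∞ in K̂ is ∞.
    witnessAt∞ : (k : ℕ) (P : Fin k → X → Set₁) (S : X → Set) →
      (∀ y → S y → (i : Fin k) → Σ X λ z → hatR K y z × S z × P i z) →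
      S ∞ → ∀ i → P i ∞
    witnessAt∞ k P S closed s∞ i with closed ∞ s∞ i
    ... | nothing , _ , _ , p = p
    ... | just _ , () , _

    -- The same in K̂: a serial set of points of K̂ that avoids ∞ is empty,
    -- since successors of points of K other than ∞ are points of K.
    noSerialSubsetAvoiding∞ : IsGL K → (S : X → Set) → ¬ S ∞ →
      (∀ y → S y → Σ X λ z → hatR K y z × S z) → ∀ x → ¬ S x
    noSerialSubsetAvoiding∞ gl S ¬s∞ serial nothing  s∞ = ¬s∞ s∞
    noSerialSubsetAvoiding∞ gl S ¬s∞ serial (just a) sa =
      noSerialSubset K gl (λ b → S (just b)) serialInK a sa
      where
      serialInK : ∀ b → S (just b) → Σ (W K) λ c → R K b c × S (just c)
      serialInK b sb with serial (just b) sb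
      ... | just c  , r , sc = c , r , sc
      ... | nothing , _ , s∞ = ⊥-elim (¬s∞ s∞)

    -- "⇒" of (★).  For k = 0 there is nothing to show; otherwise a witness
    -- set is serial, so by converse well-foundedness it must contain ∞.
    diamondStar⇒allAt∞ : IsGL K → (k : ℕ) (P : Fin k → X → Set₁) (x : X) →
      DiamondStar (hat K) k P x → ∀ i → P i ∞
    diamondStar⇒allAt∞ gl zero    P x _ ()
    diamondStar⇒allAt∞ gl (suc k) P x (S , sx , closed) with lem {Lift _ (S ∞)}
    ... | yes (lift s∞) = witnessAt∞ (suc k) P S closed s∞
    ... | no ¬s∞ = ⊥-elim (noSerialSubsetAvoiding∞ gl S (λ s∞ → ¬s∞ (lift s∞))
                             serial x sx)
      where
      serial : ∀ y → S y → Σ X λ z → hatR K y z × S z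
      serial y sy = let (z , r , sz , _) = closed y sy zero in z , r , sz

    -- "⇐" of (★): all of K̂ is a witness set, since every point sees ∞.
    allAt∞⇒diamondStar : (k : ℕ) (P : Fin k → X → Set₁) (x : X) →
      (∀ i → P i ∞) → DiamondStar (hat K) k P x
    allAt∞⇒diamondStar k P x all∞ = (λ _ → ⊤) , tt , seesInfinity
      where
      seesInfinity : ∀ y → ⊤ → (i : Fin k) →
        Σ X λ z → hatR K y z × ⊤ × P i z
      seesInfinity (just _) _ i = ∞ , tt , tt , all∞ i
      seesInfinity nothing  _ i = ∞ , tt , tt , all∞ i

    diamondStar⇔allAt∞ : IsGL K → (k : ℕ) (P : Fin k → X → Set₁) (x : X) →
      DiamondStar (hat K) k P x ⇔ (∀ i → P i ∞)
    diamondStar⇔allAt∞ gl k P x =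
      mk⇔ (diamondStar⇒allAt∞ gl k P x) (allAt∞⇒diamondStar k P x)

    diamondStar⇔BigAnd : IsGL K → (k : ℕ) (Φ : Fin k → Form) (x : X) →
      sat (hat K) (◇* k Φ) x ⇔ BigAnd (hat K) k Φ ∞
    diamondStar⇔BigAnd gl k Φ x = diamondStar⇔allAt∞ gl k (λ i → sat (hat K) (Φ i)) x

    boxStar⇔BigOr : IsGL K → (k : ℕ) (Φ : Fin k → Form) (x : X) →
      sat (hat K) (□* k Φ) x ⇔ BigOr (hat K) k Φ ∞
    boxStar⇔BigOr gl k Φ x = ⇔.trans
      (¬-cong-⇔ (diamondStar⇔allAt∞ gl k (λ i → satNeg (hat K) (Φ i)) x))
      (notAllNeg⇔BigOr (hat K) k Φ ∞)

lemma8p5 : (lem : ExcludedMiddle (lsuc 0ℓ)) (K : KripkeModel) → IsGL K →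
    (φ : Form) (x : W (hat K)) →
    (sat (hat K) (t lem K φ) x ⇔ sat (hat K) φ x)
lemma8p5 lem K gl ⊤' x = ⇔.refl
lemma8p5 lem K gl ⊥' x = ⇔.refl
lemma8p5 lem K gl (var p) x = ⇔.refl
lemma8p5 lem K gl (nvar p) x = ⇔.refl
lemma8p5 lem K gl (φ ∧' ψ) x = lemma8p5 lem K gl φ x ×-⇔ lemma8p5 lem K gl ψ x
lemma8p5 lem K gl (φ ∨' ψ) x = lemma8p5 lem K gl φ x ⊎-⇔ lemma8p5 lem K gl ψ x
lemma8p5 lem K gl (◇ φ) x =
  mk⇔ (λ (y , r , s) → y , r , to (lemma8p5 lem K gl φ y) s)
      (λ (y , r , s) → y , r , from (lemma8p5 lem K gl φ y) s)
lemma8p5 lem K gl (□ φ) x =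
  mk⇔ (λ s y r → to (lemma8p5 lem K gl φ y) (s y r))
      (λ s y r → from (lemma8p5 lem K gl φ y) (s y r))
lemma8p5 lem K gl (∀' φ) x =
  mk⇔ (λ s y → to (lemma8p5 lem K gl φ y) (s y))
      (λ s y → from (lemma8p5 lem K gl φ y) (s y))
lemma8p5 lem K gl (∃' φ) x =
  mk⇔ (λ (y , s) → y , to (lemma8p5 lem K gl φ y) s)
      (λ (y , s) → y , from (lemma8p5 lem K gl φ y) s)
lemma8p5 lem K gl (◇* k Φ) x with lem {BigAnd (hat K) k Φ ∞}
... | yes and = ⇔.trans (⊤'⇔ (hat K) x and) (⇔.sym (diamondStar⇔BigAnd lem K gl k Φ x))
... | no ¬and = ⇔.trans (⊥'⇔ (hat K) x ¬and) (⇔.sym (diamondStar⇔BigAnd lem K gl k Φ x))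
lemma8p5 lem K gl (□* k Φ) x with lem {BigOr (hat K) k Φ ∞}
... | yes or = ⇔.trans (⊤'⇔ (hat K) x or) (⇔.sym (boxStar⇔BigOr lem K gl k Φ x))
... | no ¬or = ⇔.trans (⊥'⇔ (hat K) x ¬or) (⇔.sym (boxStar⇔BigOr lem K gl k Φ x))
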